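{- Let $r\ge\max(2,D,2\|\mathcal{A}\|+1)$ be an integer, let $M\subseteq G$ be a set of vertices inducing a connected subgraph of $\Gamma$, let $C$ be the subgraph of $\Gamma$ induced by $\bigcup_{x\in M}V(B_r+x)$, let $\lambda$ be a subgraph of $\Gamma$ and $\phi:C\to\lambda$ a graph isomorphism. Then the restrictions of $\phi$ to the balls $B_r+x$, $x\in M$, all have the same orientation: $\phi(x+a)-\phi(x)=\phi(y+a)-\phi(y)$ for all $x,y\in M$ and all $a\in\mathcal{A}'$.
   Context: Let $G$ be a free abelian group of finite rank $k\ge1$, identified with $\mathbb{Z}^k$, and $\mathcal{A}\subset G$ a finite generating set with $\mathcal{A}=-\mathcal{A}$, $0\notin\mathcal{A}$. $\Gamma=\mathrm{Cay}(G,\mathcal{A})$ has vertex set $G$ and edges $\{x,x+a\}$, $a\in\mathcal{A}$. $\rho(x)$ is the length of a shortest path in $\Gamma$ from $0$ to $x$, $\omega(x)$ the number of such shortest paths. $B_r$ is the subgraph of $\Gamma$ induced by $\{x:\rho(x)\le r\}$, $B_r+x$ its translate. An element of $\mathcal{A}$ is primary if $\rho(tx)=t$ and $\omega(tx)=1$ for all integers $t\ge0$, otherwise secondary; $\mathcal{A}'$ is the set of primary elements. $D$ is a fixed positive integer such that every secondary $x\in\mathcal{A}$ satisfies $\rho(Dx)\ne D$ or $\omega(Dx)\ne1$. $\|x\|$ is the $\ell_\infty$-norm on $\mathbb{Z}^k$, $\|\mathcal{A}\|=\max_{x\in\mathcal{A}}\|x\|$. The orientation of an isomorphism $\psi$ from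 $B_r+w$ onto a subgraph of $\Gamma$ is the map $\mathcal{A}'\to G$, $a\mapsto\psi(w+a)-\psi(w)$. -}

module Defs where

open import Data.Nat as ℕ using (ℕ; suc; _⊔_; _≤_; _<_)
open import Data.Integer as ℤ using (ℤ; +_; ∣_∣)
open import Data.List as List using (List)
open import Data.List.Membership.Propositional using (_∈_)
open import Data.List.Relation.Unary.All using (All)
open import Data.Vec as Vec using (Vec; []; _∷_; head; last; toList; zipWith; replicate)
import Data.Vec.Relation.Unary.All as VAll
open import Data.Product using (Σ; _×_; ∃)
open import Data.Sum using (_⊎_)
open import Data.Unit using (⊤)
open import Relation.Binary.PropositionalEquality using (_≡_)
open import Relation.Nullary using (¬_)

G : ℕ → Set
G k = Vec ℤ k

module _ {k : ℕ} where

  0G : G k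
  0G = replicate k (+ 0)

  _+G_ : G k → G k → G k
  _+G_ = zipWith ℤ._+_

  -G_ : G k → G k
  -G_ = Vec.map (λ z → ℤ.- z)

  _-G_ : G k → G k → G k
  x -G y = x +G (-G y)

  _·G_ : ℕ → G k → G k
  t ·G x = Vec.map (λ xi → (+ t) ℤ.* xi) x

  sumG : List (G k) → G k
  sumG = List.foldr _+G_ 0G

  ∥_∥ : G k → ℕ
  ∥ x ∥ = List.foldr _⊔_ 0 (List.map ∣_∣ (toList x))

  ∥_∥ₛ : List (G k) → ℕ
  ∥ 𝒜 ∥ₛ = List.foldr _⊔_ 0 (List.map ∥_∥ 𝒜)

  Symmetric : List (G k) → Set
  Symmetric 𝒜 = ∀ a → a ∈ 𝒜 → (-G a) ∈ 𝒜

  Generates : List (G k) → Set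
  Generates 𝒜 = ∀ x → ∃ λ (ws : List (G k)) →
    All (λ w → w ∈ 𝒜 ⊎ (-G w) ∈ 𝒜) ws × sumG ws ≡ x

module _ {k : ℕ} (𝒜 : List (G k)) where

  -- adjacency in the Cayley graph Γ = Cay(G,𝒜): edge {x, x + a}, a ∈ 𝒜
  Adj : G k → G k → Set
  Adj u v = (v -G u) ∈ 𝒜

  -- a walk given by its sequence of vertices (length = number of edges)
  IsWalk : ∀ {n} → Vec (G k) (suc n) → Set
  IsWalk (v ∷ []) = ⊤
  IsWalk (u ∷ v ∷ vs) = Adj u v × IsWalk (v ∷ vs)

  WalkSeq : (n : ℕ) → G k → G k → Vec (G k) (suc n) → Set
  WalkSeq n x y vs = head vs ≡ x × last vs ≡ y × IsWalk vs

  Walk : ℕ → G k → G k → Set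
  Walk n x y = Σ (Vec (G k) (suc n)) (WalkSeq n x y)

  ρ≤ : G k → ℕ → Set
  ρ≤ x r = ∃ λ n → n ≤ r × Walk n 0G x

  ρ≡ : G k → ℕ → Set
  ρ≡ x n = Walk n 0G x × (∀ m → m < n → ¬ Walk m 0G x)

  ρ≡∧ω≡1 : G k → ℕ → Set
  ρ≡∧ω≡1 x n = ρ≡ x n ×
    (∀ vs ws → WalkSeq n 0G x vs → WalkSeq n 0G x ws → vs ≡ ws)

  Primary : G k → Set
  Primary a = ∀ (t : ℕ) → ρ≡∧ω≡1 (t ·G a) t

  GoodD : ℕ → Set
  GoodD D = 1 ≤ D × (∀ x → x ∈ 𝒜 → ¬ Primary x → ¬ ρ≡∧ω≡1 (D ·G x) D)

  InBall : ℕ → G k → G k → Set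
  InBall r x y = ρ≤ (y -G x) r

  ConnectedSet : (G k → Set) → Set
  ConnectedSet M = ∀ x y → M x → M y →
    ∃ λ n → Σ (Vec (G k) (suc n)) λ vs → WalkSeq n x y vs × VAll.All M vs

  InC : ℕ → (G k → Set) → G k → Set
  InC r M y = ∃ λ x → M x × InBall r x y

  IsSubgraph : (G k → Set) → (G k → G k → Set) → Set
  IsSubgraph LV LE =
    (∀ u v → LE u v → LE v u) ×
    (∀ u v → LE u v → LV u × LV v × Adj u v)

  IsIsoOnto : (G k → Set) → (G k → Set) → (G k → G k → Set) → (G k → G k) → Set
  IsIsoOnto VC LV LE φ =
    (∀ u → VC u → LV (φ u)) ×
    (∀ u v → VC u → VC v → φ u ≡ φ v → u ≡ v) ×
    (∀ w → LV w → ∃ λ u → VC u × φ u ≡ w) ×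
    (∀ u v → VC u → VC v → (Adj u v → LE (φ u) (φ v)) × (LE (φ u) (φ v) → Adj u v))

module Submission where

open import Defs
open import Data.Nat using (ℕ; _≤_; _⊔_; _+_; _*_)
open import Data.List using (List)
open import Data.List.Membership.Propositional using (_∈_)
open import Relation.Binary.PropositionalEquality using (_≡_)
open import Relation.Nullary using (¬_)

open import Data.Nat using (suc; zero; z≤n; _<_)
import Data.Nat.Properties as ℕP
import Data.Nat.Tactic.RingSolver as ℕSolver
open import Data.Integer as ℤ using (ℤ; +_; ∣_∣)
import Data.Integer.Properties as ℤP
open import Data.Integer.Tactic.RingSolver using (solve-∀)
open import Data.List using ([]; _∷_; length; replicate; _++_; foldl; filter; deduplicate)
import Data.List.Properties as LP
open import Data.List.Membership.Propositional using (find; lose)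
open import Data.List.Membership.Propositional.Properties using (∈-filter⁺; ∈-deduplicate⁺; ∈-deduplicate⁻)
open import Data.List.Relation.Unary.Any as Any using (Any; here; there; any?)
open import Data.List.Relation.Unary.All as All using (All; []; _∷_)
import Data.List.Relation.Unary.All.Properties as AllP
open import Data.List.Relation.Unary.AllPairs using (_∷_)
open import Data.List.Relation.Unary.Unique.Propositional using (Unique)
open import Data.List.Relation.Unary.Unique.DecPropositional.Properties using (deduplicate-!)
open import Data.Vec as Vec using (Vec; []; _∷_)
import Data.Vec.Relation.Unary.All as VAll
open import Data.Vec.Properties using (≡-dec; zipWith-assoc; zipWith-identityʳ)
open import Data.Product using (_×_; ∃; _,_; proj₁; proj₂)
open import Data.Empty using (⊥-elim)
open import Data.Unit using (tt)
open import Function using (_∘_)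
open import Relation.Binary.PropositionalEquality using (refl; sym; trans; cong; cong₂; subst; subst₂; module ≡-Reasoning)
open import Relation.Binary.Definitions using (DecidableEquality)
open import Relation.Nullary using (yes; no; ¬?)

-- Fix a primary generator a and write  slope x = φ(x + a) − φ x.
-- (1) An injective, adjacency-preserving map φ on a vertex set V sends the
--     star of any u whose star lies in V ONTO the star of φ u: it is an
--     injection of the finite set 𝒜 into itself (pigeonhole).
-- (2) Since ω(2a) = 1, the only decomposition 2a = c + c' into generators is
--     c = c' = a; with (1) this shows that φ keeps a-lines straight:
--     φ(u+2a) − φ(u+a) = φ(u+a) − φ u whenever the 2-ball at u lies in V.
-- (3) For x ∈ M the a-ray x, x+a, …, x+ra lies in B_r + x ⊆ C, so by (2)
--     φ(x + i·a) = φ x + i·slope x for i ≤ r.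
-- (4) For adjacent x, y ∈ M both φ y − φ x and
--     φ(y+ra) − φ(x+ra) = (φ y − φ x) + r·(slope y − slope x) are generators,
--     hence of norm ≤ ‖𝒜‖; as r > 2‖𝒜‖ this forces slope x = slope y.
-- (5) M is connected, so the slope is constant along walks in M.

add-sub-cancel : ∀ {k} (x c : G k) → (x +G c) -G x ≡ c
add-sub-cancel [] [] = refl
add-sub-cancel (x ∷ xs) (c ∷ cs) = cong₂ _∷_ (law x c) (add-sub-cancel xs cs)
  where
  law : ∀ (x c : ℤ) → (x ℤ.+ c) ℤ.- x ≡ c
  law = solve-∀

add-diff : ∀ {k} (x y : G k) → x +G (y -G x) ≡ y
add-diff [] [] = refl
add-diff (x ∷ xs) (y ∷ ys) = cong₂ _∷_ (law x y) (add-diff xs ys)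
  where
  law : ∀ (x y : ℤ) → x ℤ.+ (y ℤ.- x) ≡ y
  law = solve-∀

sub-zero : ∀ {k} (x : G k) → x -G 0G ≡ x
sub-zero [] = refl
sub-zero (x ∷ xs) = cong₂ _∷_ (law x) (sub-zero xs)
  where
  law : ∀ (x : ℤ) → x ℤ.- + 0 ≡ x
  law = solve-∀

two-·G : ∀ {k} (a : G k) → 2 ·G a ≡ a +G a
two-·G [] = refl
two-·G (a ∷ as) = cong₂ _∷_ (law a) (two-·G as)
  where
  law : ∀ (a : ℤ) → + 2 ℤ.* a ≡ a ℤ.+ a
  law = solve-∀

+G-swapʳ : ∀ {k} (p s t : G k) → (p +G s) +G t ≡ (p +G t) +G s
+G-swapʳ [] [] [] = refl
+G-swapʳ (p ∷ ps) (s ∷ ss) (t ∷ ts) = cong₂ _∷_ (law p s t) (+G-swapʳ ps ss ts)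
  where
  law : ∀ (p s t : ℤ) → (p ℤ.+ s) ℤ.+ t ≡ (p ℤ.+ t) ℤ.+ s
  law = solve-∀

sub-translate : ∀ {k} (p q a : G k) → (p +G a) -G (q +G a) ≡ p -G q
sub-translate [] [] [] = refl
sub-translate (p ∷ ps) (q ∷ qs) (a ∷ as) = cong₂ _∷_ (law p q a) (sub-translate ps qs as)
  where
  law : ∀ (p q a : ℤ) → (p ℤ.+ a) ℤ.- (q ℤ.+ a) ≡ p ℤ.- q
  law = solve-∀

add-zero-·G : ∀ {k} (z a : G k) → z ≡ z +G (0 ·G a)
add-zero-·G [] [] = refl
add-zero-·G (z ∷ zs) (a ∷ as) = cong₂ _∷_ (law z a) (add-zero-·G zs as)
  where
  law : ∀ (z a : ℤ) → z ≡ z ℤ.+ + 0 ℤ.* a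
  law = solve-∀

add-suc-·G : ∀ {k} (z a : G k) (i : ℕ) → (z +G (i ·G a)) +G a ≡ z +G (suc i ·G a)
add-suc-·G [] [] i = refl
add-suc-·G (z ∷ zs) (a ∷ as) i = cong₂ _∷_ (law z a (+ i)) (add-suc-·G zs as i)
  where
  law : ∀ (z a i : ℤ) → (z ℤ.+ i ℤ.* a) ℤ.+ a ≡ z ℤ.+ (+ 1 ℤ.+ i) ℤ.* a
  law = solve-∀

+G-assoc : ∀ {k} (x y z : G k) → (x +G y) +G z ≡ x +G (y +G z)
+G-assoc = zipWith-assoc ℤP.+-assoc

+G-identityʳ : ∀ {k} (x : G k) → x +G 0G ≡ x
+G-identityʳ = zipWith-identityʳ ℤP.+-identityʳ

+G-cancelˡ : ∀ {k} (u c c' : G k) → u +G c ≡ u +G c' → c ≡ c'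
+G-cancelˡ u c c' e = trans (sym (add-sub-cancel u c)) (trans (cong (_-G u) e) (add-sub-cancel u c'))

-G-cancelʳ : ∀ {k} (q p p' : G k) → p -G q ≡ p' -G q → p ≡ p'
-G-cancelʳ q p p' e = trans (sym (add-diff q p)) (trans (cong (q +G_) e) (add-diff q p'))

_≟G_ : ∀ {k} → DecidableEquality (G k)
_≟G_ = ≡-dec ℤ._≟_

ray : ∀ {k} → G k → G k → ℕ → G k
ray z a zero = z
ray z a (suc i) = ray z a i +G a

ray-scale : ∀ {k} (z a : G k) i → ray z a i ≡ z +G (i ·G a)
ray-scale z a zero = add-zero-·G z a
ray-scale z a (suc i) = trans (cong (_+G a) (ray-scale z a i)) (add-suc-·G z a i)

ray-difference : ∀ {k} (x y a : G k) i → ray y a i -G ray x a i ≡ y -G x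
ray-difference x y a zero = refl
ray-difference x y a (suc i) = trans (sub-translate (ray y a i) (ray x a i) a) (ray-difference x y a i)

rigidity-ℤ : ∀ N r (zx zy ax ay : ℤ) → 2 * N + 1 ≤ r →
  ∣ zy ℤ.- zx ∣ ≤ N → ∣ (zy ℤ.+ + r ℤ.* ay) ℤ.- (zx ℤ.+ + r ℤ.* ax) ∣ ≤ N → ax ≡ ay
rigidity-ℤ N r zx zy ax ay r-big near far =
  sym (ℤP.i-j≡0⇒i≡j ay ax (ℤP.∣i∣≡0⇒i≡0 (ℕP.n<1⇒n≡0 (ℕP.*-cancelˡ-< r _ _ r·δ<r·1))))
  where
  open ℕP.≤-Reasoning
  far-near : ∀ (R zx zy ax ay : ℤ) →
    R ℤ.* (ay ℤ.- ax) ≡ ((zy ℤ.+ R ℤ.* ay) ℤ.- (zx ℤ.+ R ℤ.* ax)) ℤ.- (zy ℤ.- zx)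
  far-near = solve-∀
  double : ∀ N → suc (N + N) ≡ 2 * N + 1
  double = ℕSolver.solve-∀
  r·δ<r·1 : r * ∣ ay ℤ.- ax ∣ < r * 1
  r·δ<r·1 = begin-strict
    r * ∣ ay ℤ.- ax ∣                                        ≡⟨ ℤP.abs-* (+ r) (ay ℤ.- ax) ⟨
    ∣ + r ℤ.* (ay ℤ.- ax) ∣                                  ≡⟨ cong ∣_∣ (far-near (+ r) zx zy ax ay) ⟩
    ∣ ((zy ℤ.+ + r ℤ.* ay) ℤ.- (zx ℤ.+ + r ℤ.* ax)) ℤ.- (zy ℤ.- zx) ∣
                                                             ≤⟨ ℤP.∣i-j∣≤∣i∣+∣j∣ ((zy ℤ.+ + r ℤ.* ay) ℤ.- (zx ℤ.+ + r ℤ.* ax)) (zy ℤ.- zx) ⟩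
    ∣ (zy ℤ.+ + r ℤ.* ay) ℤ.- (zx ℤ.+ + r ℤ.* ax) ∣ + ∣ zy ℤ.- zx ∣
                                                             ≤⟨ ℕP.+-mono-≤ far near ⟩
    N + N                                                    <⟨ ℕP.≤-trans (ℕP.≤-reflexive (double N)) r-big ⟩
    r                                                        ≡⟨ ℕP.*-identityʳ r ⟨
    r * 1                                                    ∎

rigidity : ∀ {k} N r (zx zy ax ay : G k) → 2 * N + 1 ≤ r →
  ∥ zy -G zx ∥ ≤ N → ∥ (zy +G (r ·G ay)) -G (zx +G (r ·G ax)) ∥ ≤ N → ax ≡ ay
rigidity N r [] [] [] [] r-big near far = refl
rigidity N r (zx ∷ zxs) (zy ∷ zys) (ax ∷ axs) (ay ∷ ays) r-big near far =
  cong₂ _∷_ (rigidity-ℤ N r zx zy ax ay r-big (ℕP.m⊔n≤o⇒m≤o _ _ near) (ℕP.m⊔n≤o⇒m≤o _ _ far))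
            (rigidity N r zxs zys axs ays r-big (ℕP.m⊔n≤o⇒n≤o _ _ near) (ℕP.m⊔n≤o⇒n≤o _ _ far))

norm-≤-∥∥ₛ : ∀ {k} (𝒜 : List (G k)) {c} → c ∈ 𝒜 → ∥ c ∥ ≤ ∥ 𝒜 ∥ₛ
norm-≤-∥∥ₛ (c ∷ 𝒜) (here refl) = ℕP.m≤m⊔n _ _
norm-≤-∥∥ₛ (c' ∷ 𝒜) (there c∈) = ℕP.≤-trans (norm-≤-∥∥ₛ 𝒜 c∈) (ℕP.m≤n⊔m _ _)

InjectiveOn : {A B : Set} → (A → B) → List A → Set
InjectiveOn f xs = ∀ {c c'} → c ∈ xs → c' ∈ xs → f c ≡ f c' → c ≡ c'

MapsInto : {A B : Set} → (A → B) → List A → List B → Set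
MapsInto f xs zs = ∀ {c} → c ∈ xs → f c ∈ zs

injection-length : {A B : Set} → DecidableEquality B → (f : A → B) → ∀ {xs} zs →
  Unique xs → InjectiveOn f xs → MapsInto f xs zs → length xs ≤ length zs
injection-length _≟_ f {[]} zs _ _ _ = z≤n
injection-length _≟_ f {x ∷ xs} zs (x∉xs ∷ unique) inj into = begin-strict
    length xs      ≤⟨ injection-length _≟_ f others unique (λ p q → inj (there p) (there q)) into-others ⟩
    length others  <⟨ LP.filter-notAll ≢fx? zs (Any.map (λ e ne → ne (sym e)) (into (here refl))) ⟩
    length zs      ∎
  where
  open ℕP.≤-Reasoning
  ≢fx? = λ z → ¬? (z ≟ f x)
  others = filter ≢fx? zs
  into-others : MapsInto f xs others
  into-others c∈ = ∈-filter⁺ ≢fx? (into (there c∈))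
    (λ fc≡fx → All.lookup x∉xs c∈ (inj (here refl) (there c∈) (sym fc≡fx)))

injective-onto : {A : Set} → DecidableEquality A → (f : A → A) (L : List A) →
  MapsInto f L L → InjectiveOn f L → ∀ {d} → d ∈ L → ∃ λ c → c ∈ L × f c ≡ d
injective-onto _≟_ f L into inj {d} d∈ with any? (λ c → f c ≟ d) L
... | yes hit = find hit
... | no miss = ⊥-elim (ℕP.<-irrefl refl (ℕP.≤-<-trans too-long (LP.filter-notAll ≢d? U d∈U)))
  where
  U = deduplicate _≟_ L
  ≢d? = λ z → ¬? (z ≟ d)
  d∈U : Any (λ z → ¬ ¬ (z ≡ d)) U
  d∈U = Any.map (λ e ne → ne (sym e)) (∈-deduplicate⁺ _≟_ d∈)
  -- f misses d, so it injects U into U without d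
  too-long : length U ≤ length (filter ≢d? U)
  too-long = injection-length _≟_ f (filter ≢d? U) (deduplicate-! _≟_ L)
    (λ p q → inj (∈-deduplicate⁻ _≟_ L p) (∈-deduplicate⁻ _≟_ L q))
    (λ c∈ → let c∈L = ∈-deduplicate⁻ _≟_ L c∈ in
      ∈-filter⁺ ≢d? (∈-deduplicate⁺ _≟_ (into c∈L)) (miss ∘ lose c∈L))

module CayleyWalks {k : ℕ} (𝒜 : List (G k)) where

  step-adjacent : ∀ x {c} → c ∈ 𝒜 → Adj 𝒜 x (x +G c)
  step-adjacent x {c} c∈ = subst (_∈ 𝒜) (sym (add-sub-cancel x c)) c∈

  walk-along : ∀ (x : G k) cs → All (_∈ 𝒜) cs → Walk 𝒜 (length cs) x (foldl _+G_ x cs)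
  walk-along x [] [] = x ∷ [] , refl , refl , tt
  walk-along x (c ∷ cs) (c∈ ∷ cs∈) with walk-along (x +G c) cs cs∈
  ... | v ∷ vs , refl , ends , walk = x ∷ v ∷ vs , refl , ends , step-adjacent x c∈ , walk

  foldl-translate : ∀ (x z : G k) (cs : List (G k)) → foldl _+G_ (x +G z) cs ≡ x +G foldl _+G_ z cs
  foldl-translate x z [] = refl
  foldl-translate x z (c ∷ cs) =
    trans (cong (λ w → foldl _+G_ w cs) (+G-assoc x z c)) (foldl-translate x (z +G c) cs)

  steps-in-ball : ∀ r x cs → All (_∈ 𝒜) cs → length cs ≤ r → InBall 𝒜 r x (foldl _+G_ x cs)
  steps-in-ball r x cs cs∈ len = length cs , len , subst (Walk 𝒜 (length cs) 0G) offset (walk-along 0G cs cs∈)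
    where
    open ≡-Reasoning
    offset : foldl _+G_ 0G cs ≡ foldl _+G_ x cs -G x
    offset = sym (begin
      foldl _+G_ x cs -G x             ≡⟨ cong (λ w → foldl _+G_ w cs -G x) (+G-identityʳ x) ⟨
      foldl _+G_ (x +G 0G) cs -G x     ≡⟨ cong (_-G x) (foldl-translate x 0G cs) ⟩
      (x +G foldl _+G_ 0G cs) -G x     ≡⟨ add-sub-cancel x _ ⟩
      foldl _+G_ 0G cs                 ∎)

  ray-as-steps : ∀ (z a : G k) i → foldl _+G_ z (replicate i a) ≡ ray z a i
  ray-as-steps z a zero = refl
  ray-as-steps z a (suc i) = begin
    foldl _+G_ (z +G a) (replicate i a)    ≡⟨ foldl-translate z a (replicate i a) ⟩
    z +G foldl _+G_ a (replicate i a)      ≡⟨ cong (z +G_) (ray-as-steps a a i) ⟩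
    z +G ray a a i                         ≡⟨ shift z a i ⟩
    ray z a i +G a                         ∎
    where
    open ≡-Reasoning
    shift : ∀ z a i → z +G ray a a i ≡ ray z a i +G a
    shift z a zero = refl
    shift z a (suc i) = trans (sym (+G-assoc z (ray a a i) a)) (cong (_+G a) (shift z a i))

  -- ω(2a) = 1: the only way to write 2a as a sum of two generators is a + a.
  primary-double : ∀ {a c c'} → a ∈ 𝒜 → Primary 𝒜 a → c ∈ 𝒜 → c' ∈ 𝒜 →
    c +G c' ≡ a +G a → c ≡ a
  primary-double {a} {c} {c'} a∈ prim c∈ c'∈ sum =
    sym (cong (Vec.head ∘ Vec.tail) (proj₂ (prim 2) via-a via-c walk-a walk-c))
    where
    via-a via-c : Vec (G k) 3
    via-a = 0G ∷ a ∷ (2 ·G a) ∷ []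
    via-c = 0G ∷ c ∷ (2 ·G a) ∷ []
    second-step : ∀ {b b'} → b' ∈ 𝒜 → b +G b' ≡ a +G a → ((2 ·G a) -G b) ∈ 𝒜
    second-step {b} {b'} b'∈ e =
      subst (_∈ 𝒜) (trans (sym (add-sub-cancel b b')) (cong (_-G b) (trans e (sym (two-·G a))))) b'∈
    walk-a : WalkSeq 𝒜 2 0G (2 ·G a) via-a
    walk-a = refl , refl , subst (_∈ 𝒜) (sym (sub-zero a)) a∈ , second-step a∈ refl , tt
    walk-c : WalkSeq 𝒜 2 0G (2 ·G a) via-c
    walk-c = refl , refl , subst (_∈ 𝒜) (sym (sub-zero c)) c∈ , second-step c'∈ sum , tt

module LocalEmbedding {k : ℕ} (𝒜 : List (G k)) (V : G k → Set) (φ : G k → G k)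
  (φ-inj : ∀ {u v} → V u → V v → φ u ≡ φ v → u ≡ v)
  (φ-adj : ∀ {u v} → V u → V v → Adj 𝒜 u v → Adj 𝒜 (φ u) (φ v)) where

  open CayleyWalks 𝒜

  StarIn : G k → Set
  StarIn u = V u × (∀ {c} → c ∈ 𝒜 → V (u +G c))

  star-onto : ∀ {u} → StarIn u → ∀ {d} → d ∈ 𝒜 → ∃ λ c → c ∈ 𝒜 × φ (u +G c) ≡ φ u +G d
  star-onto {u} (Vu , Vnb) d∈ =
    let c , c∈ , e = injective-onto _≟G_ step 𝒜 into inj d∈
    in c , c∈ , trans (sym (add-diff (φ u) _)) (cong (φ u +G_) e)
    where
    step : G k → G k
    step c = φ (u +G c) -G φ u
    into : MapsInto step 𝒜 𝒜
    into c∈ = φ-adj Vu (Vnb c∈) (step-adjacent u c∈)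
    inj : InjectiveOn step 𝒜
    inj {c} {c'} p q e = +G-cancelˡ u c c' (φ-inj (Vnb p) (Vnb q) (-G-cancelʳ (φ u) _ _ e))

  straight : ∀ {a u} → a ∈ 𝒜 → Primary 𝒜 a → StarIn u → (∀ {c} → c ∈ 𝒜 → StarIn (u +G c)) →
    φ ((u +G a) +G a) -G φ (u +G a) ≡ φ (u +G a) -G φ u
  straight {a} {u} a∈ prim star-u star-nb = sym (begin
      φ (u +G a) -G φ u            ≡⟨ cong (λ b → φ (u +G b) -G φ u) (sym c≡a) ⟩
      φ (u +G c) -G φ u            ≡⟨ cong (_-G φ u) φ[u+c] ⟩
      (φ u +G α₂) -G φ u           ≡⟨ add-sub-cancel (φ u) α₂ ⟩
      α₂                           ∎)
    where
    open ≡-Reasoning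
    V₀ = proj₁ star-u
    V₁ = proj₂ star-u a∈
    V₂ = proj₂ (star-nb a∈) a∈
    α₁ = φ (u +G a) -G φ u
    α₂ = φ ((u +G a) +G a) -G φ (u +G a)
    first = star-onto star-u (φ-adj V₁ V₂ (step-adjacent (u +G a) a∈))
    c = proj₁ first
    c∈ = proj₁ (proj₂ first)
    φ[u+c] : φ (u +G c) ≡ φ u +G α₂
    φ[u+c] = proj₂ (proj₂ first)
    second = star-onto (star-nb c∈) (φ-adj V₀ V₁ (step-adjacent u a∈))
    c' = proj₁ second
    c'∈ = proj₁ (proj₂ second)
    φ[u+c+c'] : φ ((u +G c) +G c') ≡ φ (u +G c) +G α₁
    φ[u+c+c'] = proj₂ (proj₂ second)
    same-image : φ ((u +G c) +G c') ≡ φ ((u +G a) +G a)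
    same-image = begin
      φ ((u +G c) +G c')           ≡⟨ φ[u+c+c'] ⟩
      φ (u +G c) +G α₁             ≡⟨ cong (_+G α₁) φ[u+c] ⟩
      (φ u +G α₂) +G α₁            ≡⟨ +G-swapʳ (φ u) α₂ α₁ ⟩
      (φ u +G α₁) +G α₂            ≡⟨ cong (_+G α₂) (add-diff (φ u) _) ⟩
      φ (u +G a) +G α₂             ≡⟨ add-diff (φ (u +G a)) _ ⟩
      φ ((u +G a) +G a)            ∎
    c+c'≡a+a : c +G c' ≡ a +G a
    c+c'≡a+a = +G-cancelˡ u _ _ (trans (sym (+G-assoc u c c'))
      (trans (φ-inj (proj₂ (star-nb c∈) c'∈) V₂ same-image) (+G-assoc u a a)))
    c≡a : c ≡ a
    c≡a = primary-double a∈ prim c∈ c'∈ c+c'≡a+a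

module BallUnion {k : ℕ} (𝒜 : List (G k)) (r : ℕ) (M : G k → Set) (φ : G k → G k)
  (φ-inj : ∀ {u v} → InC 𝒜 r M u → InC 𝒜 r M v → φ u ≡ φ v → u ≡ v)
  (φ-adj : ∀ {u v} → InC 𝒜 r M u → InC 𝒜 r M v → Adj 𝒜 u v → Adj 𝒜 (φ u) (φ v))
  {a : G k} (a∈ : a ∈ 𝒜) (prim : Primary 𝒜 a) where

  open CayleyWalks 𝒜
  open LocalEmbedding 𝒜 (InC 𝒜 r M) φ φ-inj φ-adj

  slope : G k → G k
  slope x = φ (x +G a) -G φ x

  ray-in-C : ∀ {x} → M x → ∀ i ext → All (_∈ 𝒜) ext → i + length ext ≤ r →
    InC 𝒜 r M (foldl _+G_ (ray x a i) ext)
  ray-in-C {x} Mx i ext ext∈ len = x , Mx ,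
    subst (InBall 𝒜 r x) endpoint
      (steps-in-ball r x (replicate i a ++ ext) (AllP.++⁺ (AllP.replicate⁺ i a∈) ext∈) total)
    where
    total : length (replicate i a ++ ext) ≤ r
    total = subst (_≤ r) (sym (trans (LP.length-++ (replicate i a)) (cong (_+ length ext) (LP.length-replicate i)))) len
    endpoint : foldl _+G_ x (replicate i a ++ ext) ≡ foldl _+G_ (ray x a i) ext
    endpoint = trans (LP.foldl-++ _+G_ x (replicate i a) ext) (cong (λ z → foldl _+G_ z ext) (ray-as-steps x a i))

  ray-star : ∀ {x} → M x → ∀ i → i + 2 ≤ r → StarIn (ray x a i)
  ray-star Mx i len =
    ray-in-C Mx i [] [] (ℕP.≤-trans (ℕP.+-monoʳ-≤ i z≤n) len) ,
    λ c∈ → ray-in-C Mx i (_ ∷ []) (c∈ ∷ []) (ℕP.≤-trans (ℕP.+-monoʳ-≤ i (ℕP.n≤1+n 1)) len)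

  ray-star² : ∀ {x} → M x → ∀ i → i + 2 ≤ r → ∀ {c} → c ∈ 𝒜 → StarIn (ray x a i +G c)
  ray-star² Mx i len c∈ =
    ray-in-C Mx i (_ ∷ []) (c∈ ∷ []) (ℕP.≤-trans (ℕP.+-monoʳ-≤ i (ℕP.n≤1+n 1)) len) ,
    λ c'∈ → ray-in-C Mx i (_ ∷ _ ∷ []) (c∈ ∷ c'∈ ∷ []) len

  ray-steps-constant : ∀ {x} → M x → ∀ i → suc i ≤ r → φ (ray x a (suc i)) -G φ (ray x a i) ≡ slope x
  ray-steps-constant Mx zero _ = refl
  ray-steps-constant {x} Mx (suc i) len =
    trans (straight a∈ prim (ray-star Mx i i+2≤r) (ray-star² Mx i i+2≤r))
          (ray-steps-constant Mx i (ℕP.<⇒≤ len))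
    where
    i+2≤r : i + 2 ≤ r
    i+2≤r = subst (_≤ r) (ℕP.+-comm 2 i) len

  ray-affine : ∀ {x} → M x → ∀ i → i ≤ r → φ (ray x a i) ≡ ray (φ x) (slope x) i
  ray-affine Mx zero _ = refl
  ray-affine {x} Mx (suc i) len =
    trans (sym (add-diff (φ (ray x a i)) _))
          (cong₂ _+G_ (ray-affine Mx i (ℕP.<⇒≤ len)) (ray-steps-constant Mx i len))

  slope-adjacent : 2 * ∥ 𝒜 ∥ₛ + 1 ≤ r → ∀ {x y} → M x → M y → Adj 𝒜 x y → slope x ≡ slope y
  slope-adjacent r-big {x} {y} Mx My adj =
    rigidity ∥ 𝒜 ∥ₛ r (φ x) (φ y) (slope x) (slope y) r-big
      (norm-≤-∥∥ₛ 𝒜 (φ-adj (centre Mx) (centre My) adj))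
      (norm-≤-∥∥ₛ 𝒜 (subst (_∈ 𝒜) (cong₂ _-G_ (far-end My) (far-end Mx)) far-adj))
    where
    centre : ∀ {z} → M z → InC 𝒜 r M z
    centre Mz = ray-in-C Mz 0 [] [] z≤n
    tip : ∀ {z} → M z → InC 𝒜 r M (ray z a r)
    tip Mz = ray-in-C Mz r [] [] (ℕP.≤-reflexive (ℕP.+-identityʳ r))
    far-end : ∀ {z} → M z → φ (ray z a r) ≡ φ z +G (r ·G slope z)
    far-end {z} Mz = trans (ray-affine Mz r ℕP.≤-refl) (ray-scale (φ z) (slope z) r)
    far-adj : Adj 𝒜 (φ (ray x a r)) (φ (ray y a r))
    far-adj = φ-adj (tip Mx) (tip My) (subst (_∈ 𝒜) (sym (ray-difference x y a r)) adj)

  slope-along-walk : 2 * ∥ 𝒜 ∥ₛ + 1 ≤ r → ∀ n (vs : Vec (G k) (suc n)) → IsWalk 𝒜 vs → VAll.All M vs →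
    slope (Vec.head vs) ≡ slope (Vec.last vs)
  slope-along-walk r-big zero (v ∷ []) _ _ = refl
  slope-along-walk r-big (suc n) (u ∷ v ∷ vs) (adj , walk) (Mu VAll.∷ Ms) =
    trans (slope-adjacent r-big Mu (VAll.head Ms) adj) (slope-along-walk r-big n (v ∷ vs) walk Ms)

corollary3 : (k : ℕ) → 1 ≤ k → (𝒜 : List (G k)) →
    Symmetric 𝒜 → ¬ (0G ∈ 𝒜) → Generates 𝒜 →
    (D : ℕ) → GoodD 𝒜 D →
    (r : ℕ) → 2 ⊔ D ⊔ (2 * ∥ 𝒜 ∥ₛ + 1) ≤ r →
    (M : G k → Set) → ConnectedSet 𝒜 M →
    (LV : G k → Set) → (LE : G k → G k → Set) → IsSubgraph 𝒜 LV LE →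
    (φ : G k → G k) → IsIsoOnto 𝒜 (InC 𝒜 r M) LV LE φ →
    ∀ x y a → M x → M y → a ∈ 𝒜 → Primary 𝒜 a →
    φ (x +G a) -G φ x ≡ φ (y +G a) -G φ y
corollary3 k _ 𝒜 _ _ _ D _ r r-bound M connected LV LE (_ , λ-in-Γ) φ (_ , φ-inj , _ , φ-edges)
  x y a Mx My a∈ prim with connected x y Mx My
... | n , vs , (starts , ends , walk) , inM =
  subst₂ (λ p q → slope p ≡ slope q) starts ends (slope-along-walk r-big n vs walk inM)
  where
  r-big : 2 * ∥ 𝒜 ∥ₛ + 1 ≤ r
  r-big = ℕP.m⊔n≤o⇒n≤o (2 ⊔ D) _ r-bound
  -- φ is injective on C and, since λ ⊆ Γ, sends edges of C to edges of Γ
  φ-adj : ∀ {u v} → InC 𝒜 r M u → InC 𝒜 r M v → Adj 𝒜 u v → Adj 𝒜 (φ u) (φ v)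
  φ-adj {u} {v} Cu Cv adj = proj₂ (proj₂ (λ-in-Γ (φ u) (φ v) (proj₁ (φ-edges u v Cu Cv) adj)))
  open BallUnion 𝒜 r M φ (φ-inj _ _) φ-adj a∈ prim
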